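{- For any integer $n\ge 2$, the polynomial $$\ell_I(\Gamma(D_n),x)=\sum_{i=1}^{\lfloor n/2\rfloor}\frac{n-2}{i}\binom{2i-2}{i-1}\binom{n-2}{2i-2}x^i(1+x)^{n-2i}$$ has only real zeros.
   Context: This polynomial is the local $h$-polynomial of the type $D_n$ cluster subdivision. A polynomial has only real zeros if all of its complex zeros are real (the zero polynomial being regarded as trivially satisfying this). -}

module Defs where

open import Level using (0ℓ)
open import Data.Nat as ℕ using (ℕ; zero; suc; _∸_; ⌊_/2⌋)
open import Data.Nat.DivMod using (_/_)
open import Data.Nat.Combinatorics using (_C_)
open import Data.Product using (Σ; _×_; _,_; ∃)
open import Data.Sum using (_⊎_)
open import Relation.Nullary using (¬_)
open import Relation.Binary.PropositionalEquality using (_≡_)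
open import Relation.Binary.Structures using (IsTotalOrder)
open import Algebra.Structures using (IsCommutativeRing)

-- The real numbers, given axiomatically: a complete ordered field.
-- Any two models are isomorphic, so quantifying over all models of this
-- record is the same as talking about ℝ.

record RealNumbers : Set₁ where
  infixl 6 _+_
  infixl 7 _*_
  infix  4 _≤_
  field
    Carrier : Set
    _+_ _*_ : Carrier → Carrier → Carrier
    -_      : Carrier → Carrier
    0# 1#   : Carrier
    _≤_     : Carrier → Carrier → Set
    isCommutativeRing : IsCommutativeRing _≡_ _+_ _*_ -_ 0# 1#
    0≢1     : ¬ (0# ≡ 1#)
    inverse : ∀ x → ¬ (x ≡ 0#) → Σ Carrier (λ y → x * y ≡ 1#)
    isTotalOrder : IsTotalOrder _≡_ _≤_
    +-mono-≤ : ∀ x y z → x ≤ y → x + z ≤ y + z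
    *-nonneg : ∀ x y → 0# ≤ x → 0# ≤ y → 0# ≤ x * y
    sup : (P : Carrier → Set) → ∃ P →
          Σ Carrier (λ b → ∀ x → P x → x ≤ b) →
          Σ Carrier (λ s → (∀ x → P x → x ≤ s) ×
                           (∀ b → (∀ x → P x → x ≤ b) → s ≤ b))

module Complex (R : RealNumbers) where
  open RealNumbers R

  ℂ : Set
  ℂ = Carrier × Carrier

  re im : ℂ → Carrier
  re (a , _) = a
  im (_ , b) = b

  fromℕᴿ : ℕ → Carrier
  fromℕᴿ zero    = 0#
  fromℕᴿ (suc n) = 1# + fromℕᴿ n

  0ᶜ 1ᶜ : ℂ
  0ᶜ = 0# , 0#
  1ᶜ = 1# , 0#

  fromℕᶜ : ℕ → ℂ
  fromℕᶜ n = fromℕᴿ n , 0#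

  _+ᶜ_ : ℂ → ℂ → ℂ
  (a , b) +ᶜ (c , d) = (a + c) , (b + d)

  _*ᶜ_ : ℂ → ℂ → ℂ
  (a , b) *ᶜ (c , d) = (a * c + - (b * d)) , (a * d + b * c)

  _^ᶜ_ : ℂ → ℕ → ℂ
  z ^ᶜ zero  = 1ᶜ
  z ^ᶜ suc k = z *ᶜ (z ^ᶜ k)

  sumFrom1 : ℕ → (ℕ → ℂ) → ℂ
  sumFrom1 zero    f = 0ᶜ
  sumFrom1 (suc m) f = sumFrom1 m f +ᶜ f (suc m)

  -- "the polynomial function p : ℂ → ℂ has only real zeros":
  -- either p is the zero polynomial (identically zero on the infinite
  -- field ℂ), or every complex zero of p has imaginary part 0.
  OnlyRealZeros : (ℂ → ℂ) → Set
  OnlyRealZeros p = (∀ z → p z ≡ 0ᶜ) ⊎ (∀ z → p z ≡ 0ᶜ → im z ≡ 0#)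

-- Coefficient  (n-2)/i * binom(2i-2, i-1) * binom(n-2, 2i-2)  for i ≥ 1.
-- Written as ((n-2) * binom(2i-2,i-1) * binom(n-2,2i-2)) / i, the division
-- being exact since i ∣ binom(2i-2,i-1) (Catalan numbers).

coeff : ℕ → ℕ → ℕ
coeff n zero    = 0
coeff n (suc k) =
  ((n ∸ 2) ℕ.* ((2 ℕ.* k) C k) ℕ.* ((n ∸ 2) C (2 ℕ.* k))) / suc k

module _ (R : RealNumbers) where
  open Complex R

  localHD : ℕ → ℂ → ℂ
  localHD n z = sumFrom1 ⌊ n /2⌋ (λ i →
    fromℕᶜ (coeff n i) *ᶜ ((z ^ᶜ i) *ᶜ ((1ᶜ +ᶜ z) ^ᶜ (n ∸ (2 ℕ.* i)))))

-- For n = m + 2 the polynomial is m · x · N m x, where N m x = Σⱼ C(m,2j) Catⱼ xʲ (1+x)^(m-2j) is the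
-- Narayana polynomial of order m + 1 written in its γ-basis. The factorial form of the coefficients
-- gives the three-term recurrence (k+4) N(k+2) = (2k+5)(1+x) N(k+1) - (k+1)(1-x)² N k.
-- Fix z with Im z = s and put D u v = Im (u · conj v · (1 - conj z)). The recurrence yields
-- (k+4) D(N(k+2), N(k+1)) = 2(2k+5) s |N(k+1)|² + (k+1) |1-z|² D(N(k+1), N k), and D(N 1, N 0) = 2s,
-- so D(N(k+1), N k) = s · F k with F k > 0; F k could only vanish at z = 1, where N m 1 ≠ 0.
-- If z · N(k+1) z = 0 then s |N(k+1) z|² = Im (z N(k+1) · conj N(k+1)) = 0 and
-- |z|² s F k = D(z N(k+1), z N k) = 0; as N m 0 = 1, |z|² + |N(k+1) z|² ≠ 0, hence s = 0.

module Submission where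

open import Defs
open import Algebra using (CommutativeRing; Semiring)
open import Data.Nat as ℕ using (ℕ; zero; suc)
import Data.Nat.Properties as ℕ
open import Data.Integer using (+_)
open import Data.Sum using (inj₁; inj₂)
open import Relation.Binary.PropositionalEquality as ≡ using (_≡_)

module _ where

  open import Data.Nat
  open import Data.Nat.Properties
  open import Data.Nat.Combinatorics using (_C_; nCk≡n!/k![n-k]!; k>n⇒nCk≡0; k![n∸k]!∣n!; [n-k]*d[k+1]≡[k+1]*d[k])
  open import Data.Nat.DivMod using (_/_; m/n*n≡m; m*n/n≡m)
  open import Data.Nat.Tactic.RingSolver using (solve-∀)
  open import Relation.Binary.PropositionalEquality
  open import Relation.Nullary using (yes; no)
  open ≡-Reasoning

  nCk*[k!*[n∸k]!]≡n! : ∀ {n k} → k ≤ n → (n C k) * (k ! * (n ∸ k) !) ≡ n !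
  nCk*[k!*[n∸k]!]≡n! {n} {k} k≤n = begin
    (n C k) * (k ! * (n ∸ k) !)                  ≡⟨ cong (_* (k ! * (n ∸ k) !)) (nCk≡n!/k![n-k]! k≤n) ⟩
    n ! / (k ! * (n ∸ k) !) * (k ! * (n ∸ k) !)  ≡⟨ m/n*n≡m (k![n∸k]!∣n! k≤n) ⟩
    n !                                          ∎
    where instance _ = k !* (n ∸ k) !≢0

  nC[1+k]*[1+k]≡nCk*[n∸k] : ∀ {n k} → k < n → (n C suc k) * suc k ≡ (n C k) * (n ∸ k)
  nC[1+k]*[1+k]≡nCk*[n∸k] {n} {k} k<n = *-cancelʳ-≡ _ _ (k ! * (n ∸ k) !) (begin
    (n C suc k) * suc k * d[k]        ≡⟨ *-assoc (n C suc k) (suc k) d[k] ⟩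
    (n C suc k) * (suc k * d[k])      ≡⟨ cong ((n C suc k) *_) ([n-k]*d[k+1]≡[k+1]*d[k] k<n) ⟨
    (n C suc k) * ((n ∸ k) * d[k+1])  ≡⟨ x*[y*z]≡y*[x*z] (n C suc k) (n ∸ k) d[k+1] ⟩
    (n ∸ k) * ((n C suc k) * d[k+1])  ≡⟨ cong ((n ∸ k) *_) (nCk*[k!*[n∸k]!]≡n! k<n) ⟩
    (n ∸ k) * n !                     ≡⟨ cong ((n ∸ k) *_) (nCk*[k!*[n∸k]!]≡n! (<⇒≤ k<n)) ⟨
    (n ∸ k) * ((n C k) * d[k])        ≡⟨ x*[y*z]≡y*[x*z] (n ∸ k) (n C k) d[k] ⟩
    (n C k) * ((n ∸ k) * d[k])        ≡⟨ *-assoc (n C k) (n ∸ k) d[k] ⟨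
    (n C k) * (n ∸ k) * d[k]          ∎)
    where
    instance _ = k !* (n ∸ k) !≢0
    d[k] = k ! * (n ∸ k) !
    d[k+1] = suc k ! * (n ∸ suc k) !
    x*[y*z]≡y*[x*z] : ∀ x y z → x * (y * z) ≡ y * (x * z)
    x*[y*z]≡y*[x*z] = solve-∀

  catalan : ℕ → ℕ
  catalan j = (2 * j) C j ∸ (2 * j) C suc j

  2*n∸n≡n : ∀ n → 2 * n ∸ n ≡ n
  2*n∸n≡n n = trans (m+n∸m≡n n (n + 0)) (+-identityʳ n)

  catalan*[1+j]≡[2j]Cj : ∀ j → catalan j * suc j ≡ (2 * j) C j
  catalan*[1+j]≡[2j]Cj zero      = refl
  catalan*[1+j]≡[2j]Cj j@(suc i) = begin
    (c₀ ∸ c₁) * suc j        ≡⟨ *-distribʳ-∸ (suc j) c₀ c₁ ⟩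
    c₀ * suc j ∸ c₁ * suc j  ≡⟨ cong₂ _∸_ (*-suc c₀ j) c₁*[1+j]≡c₀*j ⟩
    c₀ + c₀ * j ∸ c₀ * j     ≡⟨ m+n∸n≡m c₀ (c₀ * j) ⟩
    c₀                       ∎
    where
    c₀ = (2 * j) C j
    c₁ = (2 * j) C suc j
    c₁*[1+j]≡c₀*j : c₁ * suc j ≡ c₀ * j
    c₁*[1+j]≡c₀*j = trans (nC[1+k]*[1+k]≡nCk*[n∸k] (m<m+n j (s≤s z≤n))) (cong (c₀ *_) (2*n∸n≡n j))

  catalan*[j!*[1+j]!]≡[2j]! : ∀ j → catalan j * (j ! * suc j !) ≡ (2 * j) !
  catalan*[j!*[1+j]!]≡[2j]! j = begin
    catalan j * (j ! * (suc j * j !))      ≡⟨ reassoc (catalan j) (suc j) (j !) ⟩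
    catalan j * suc j * (j ! * j !)        ≡⟨ cong (_* (j ! * j !)) (catalan*[1+j]≡[2j]Cj j) ⟩
    ((2 * j) C j) * (j ! * j !)            ≡⟨ cong (λ n → ((2 * j) C j) * (j ! * n !)) (2*n∸n≡n j) ⟨
    ((2 * j) C j) * (j ! * (2 * j ∸ j) !)  ≡⟨ nCk*[k!*[n∸k]!]≡n! (m≤m+n j (j + 0)) ⟩
    (2 * j) !                              ∎
    where
    reassoc : ∀ c s f → c * (f * (s * f)) ≡ c * s * (f * f)
    reassoc = solve-∀

  γ : ℕ → ℕ → ℕ
  γ m j = (m C (2 * j)) * catalan j

  γ-vanishes : ∀ {m} j → m < 2 * j → γ m j ≡ 0
  γ-vanishes j m<2j = cong (_* catalan j) (k>n⇒nCk≡0 m<2j)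

  γ*[r!*[j!*[1+j]!]]≡m! : ∀ {m} j r → 2 * j + r ≡ m → γ m j * (r ! * (j ! * suc j !)) ≡ m !
  γ*[r!*[j!*[1+j]!]]≡m! j r refl = begin
    c * catalan j * (r ! * d)                 ≡⟨ reassoc c (catalan j) (r !) d ⟩
    c * (catalan j * d * r !)                 ≡⟨ cong (λ x → c * (x * r !)) (catalan*[j!*[1+j]!]≡[2j]! j) ⟩
    c * ((2 * j) ! * r !)                     ≡⟨ cong (λ n → c * ((2 * j) ! * n !)) (m+n∸m≡n (2 * j) r) ⟨
    c * ((2 * j) ! * (2 * j + r ∸ 2 * j) !)   ≡⟨ nCk*[k!*[n∸k]!]≡n! (m≤m+n (2 * j) r) ⟩
    (2 * j + r) !                             ∎
    where
    c = (2 * j + r) C (2 * j)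
    d = j ! * suc j !
    reassoc : ∀ c t f d → c * t * (f * d) ≡ c * (t * d * f)
    reassoc = solve-∀

  m≤1+2i⇒m<2[1+i] : ∀ {m} i → m ≤ 1 + 2 * i → m < 2 * suc i
  m≤1+2i⇒m<2[1+i] {m} i m≤1+2i = ≤-trans (s≤s m≤1+2i) (≤-reflexive (sym (+-suc (suc i) (i + 0))))

  m≤1+2⌊m/2⌋ : ∀ m → m ≤ 1 + 2 * ⌊ m /2⌋
  m≤1+2⌊m/2⌋ zero          = z≤n
  m≤1+2⌊m/2⌋ (suc zero)    = s≤s z≤n
  m≤1+2⌊m/2⌋ (suc (suc m)) = ≤-trans (s≤s (s≤s (m≤1+2⌊m/2⌋ m))) (≤-reflexive (3+2h≡1+2[1+h] ⌊ m /2⌋))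
    where
    3+2h≡1+2[1+h] : ∀ h → 3 + 2 * h ≡ 1 + 2 * suc h
    3+2h≡1+2[1+h] = solve-∀

  m<2*[1+⌊m/2⌋] : ∀ m → m < 2 * suc ⌊ m /2⌋
  m<2*[1+⌊m/2⌋] m = m≤1+2i⇒m<2[1+i] ⌊ m /2⌋ (m≤1+2⌊m/2⌋ m)

  module _ (i : ℕ) where

    private
      P = (1 + i) * (2 + i)
      instance _ = m*n≢0 (1 + i) (2 + i)

    γ-ratio₂ : ∀ {k} r → 2 * i + r ≡ k → γ (2 + k) (suc i) * P ≡ (2 + k) * (1 + k) * γ k i
    γ-ratio₂ r refl = *-cancelʳ-≡ _ _ (r ! * (i ! * suc i !)) {{M≢0}} (begin
      γ (2 + k) (suc i) * P * M                             ≡⟨ reassoc (γ (2 + k) (suc i)) i (i !) (r !) ⟩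
      γ (2 + k) (suc i) * (r ! * (suc i ! * (2 + i) !))     ≡⟨ γ*[r!*[j!*[1+j]!]]≡m! (suc i) r (2*[1+i]+r i r) ⟩
      (2 + k) * ((1 + k) * k !)                             ≡⟨ cong (λ x → (2 + k) * ((1 + k) * x)) (γ*[r!*[j!*[1+j]!]]≡m! i r refl) ⟨
      (2 + k) * ((1 + k) * (γ k i * M))                     ≡⟨ reassoc′ (2 + k) (1 + k) (γ k i) M ⟩
      (2 + k) * (1 + k) * γ k i * M                         ∎)
      where
      k = 2 * i + r
      M = r ! * (i ! * suc i !)
      M≢0 = m*n≢0 (r !) (i ! * suc i !) {{r !≢0}} {{i !* suc i !≢0}}
      2*[1+i]+r : ∀ i r → 2 * suc i + r ≡ 2 + (2 * i + r)
      2*[1+i]+r = solve-∀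
      reassoc : ∀ g i f ρ → g * ((1 + i) * (2 + i)) * (ρ * (f * ((1 + i) * f)))
                          ≡ g * (ρ * (((1 + i) * f) * ((2 + i) * ((1 + i) * f))))
      reassoc = solve-∀
      reassoc′ : ∀ a b g m → a * (b * (g * m)) ≡ a * b * g * m
      reassoc′ = solve-∀

    γ-ratio₁ : ∀ {k} r → 2 * i + r ≡ k → γ (1 + k) (suc i) * P ≡ (1 + k) * r * γ k i
    γ-ratio₁ zero    refl = begin
      γ (1 + (2 * i + 0)) (suc i) * P          ≡⟨ cong (_* P) (γ-vanishes (suc i) (m≤1+2i⇒m<2[1+i] i (s≤s (≤-reflexive (+-identityʳ _))))) ⟩
      0                                        ≡⟨ cong (_* γ (2 * i + 0) i) (*-zeroʳ (1 + (2 * i + 0))) ⟨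
      (1 + (2 * i + 0)) * 0 * γ (2 * i + 0) i  ∎
    γ-ratio₁ (suc t) refl = *-cancelʳ-≡ _ _ (suc t ! * (i ! * suc i !)) {{M≢0}} (begin
      γ (1 + k) (suc i) * P * M                                 ≡⟨ reassoc (γ (1 + k) (suc i)) i t (i !) (t !) ⟩
      suc t * (γ (1 + k) (suc i) * (t ! * (suc i ! * (2 + i) !))) ≡⟨ cong (suc t *_) (γ*[r!*[j!*[1+j]!]]≡m! (suc i) t (2*[1+i]+t i t)) ⟩
      suc t * ((1 + k) * k !)                                   ≡⟨ cong (λ x → suc t * ((1 + k) * x)) (γ*[r!*[j!*[1+j]!]]≡m! i (suc t) refl) ⟨
      suc t * ((1 + k) * (γ k i * M))                           ≡⟨ reassoc′ (suc t) (1 + k) (γ k i) M ⟩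
      (1 + k) * suc t * γ k i * M                               ∎)
      where
      k = 2 * i + suc t
      M = suc t ! * (i ! * suc i !)
      M≢0 = m*n≢0 (suc t !) (i ! * suc i !) {{suc t !≢0}} {{i !* suc i !≢0}}
      2*[1+i]+t : ∀ i t → 2 * suc i + t ≡ 1 + (2 * i + suc t)
      2*[1+i]+t = solve-∀
      reassoc : ∀ g i t f ρ → g * ((1 + i) * (2 + i)) * ((1 + t) * ρ * (f * ((1 + i) * f)))
                            ≡ (1 + t) * (g * (ρ * (((1 + i) * f) * ((2 + i) * ((1 + i) * f)))))
      reassoc = solve-∀
      reassoc′ : ∀ s a g m → s * (a * (g * m)) ≡ a * s * g * m
      reassoc′ = solve-∀

    -- r (r - 1) γ k i, with r γ k i moved to the left to avoid truncated subtraction.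
    γ-ratio₀ : ∀ {k} r → 2 * i + r ≡ k → γ k (suc i) * P + r * γ k i ≡ r * r * γ k i
    γ-ratio₀ zero          refl = cong (λ x → x * P + 0)
      (γ-vanishes (suc i) (m≤1+2i⇒m<2[1+i] i (≤-trans (≤-reflexive (+-identityʳ _)) (n≤1+n _))))
    γ-ratio₀ (suc zero)    refl = cong (λ x → x * P + 1 * γ (2 * i + 1) i)
      (γ-vanishes (suc i) (m≤1+2i⇒m<2[1+i] i (≤-reflexive (+-comm _ 1))))
    γ-ratio₀ (suc (suc t)) refl = begin
      γ k (suc i) * P + r * γ k i        ≡⟨ cong (_+ r * γ k i) γ[k,1+i]*P≡r*[1+t]*γ[k,i] ⟩
      r * suc t * γ k i + r * γ k i      ≡⟨ r*[1+t]*g+r*g≡r*r*g (γ k i) t ⟩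
      r * r * γ k i                      ∎
      where
      k = 2 * i + suc (suc t)
      r = suc (suc t)
      M = r ! * (i ! * suc i !)
      M≢0 = m*n≢0 (r !) (i ! * suc i !) {{r !≢0}} {{i !* suc i !≢0}}
      2*[1+i]+t : ∀ i t → 2 * suc i + t ≡ 2 * i + suc (suc t)
      2*[1+i]+t = solve-∀
      reassoc : ∀ g i t f ρ → g * ((1 + i) * (2 + i)) * ((2 + t) * ((1 + t) * ρ) * (f * ((1 + i) * f)))
                            ≡ (2 + t) * (1 + t) * (g * (ρ * (((1 + i) * f) * ((2 + i) * ((1 + i) * f)))))
      reassoc = solve-∀
      reassoc′ : ∀ s g m → s * (g * m) ≡ s * g * m
      reassoc′ = solve-∀
      r*[1+t]*g+r*g≡r*r*g : ∀ g t → (2 + t) * (1 + t) * g + (2 + t) * g ≡ (2 + t) * (2 + t) * g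
      r*[1+t]*g+r*g≡r*r*g = solve-∀
      γ[k,1+i]*P≡r*[1+t]*γ[k,i] : γ k (suc i) * P ≡ r * suc t * γ k i
      γ[k,1+i]*P≡r*[1+t]*γ[k,i] = *-cancelʳ-≡ _ _ M {{M≢0}} (begin
        γ k (suc i) * P * M                                 ≡⟨ reassoc (γ k (suc i)) i t (i !) (t !) ⟩
        r * suc t * (γ k (suc i) * (t ! * (suc i ! * (2 + i) !))) ≡⟨ cong (r * suc t *_) (γ*[r!*[j!*[1+j]!]]≡m! (suc i) t (2*[1+i]+t i t)) ⟩
        r * suc t * k !                                     ≡⟨ cong (r * suc t *_) (γ*[r!*[j!*[1+j]!]]≡m! i r refl) ⟨
        r * suc t * (γ k i * M)                             ≡⟨ reassoc′ (r * suc t) (γ k i) M ⟩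
        r * suc t * γ k i * M                               ∎)

  -- After multiplying by (1+i)(2+i), every term is a multiple of γ k i by the γ-ratio lemmas.
  γ-recurrence : ∀ k i → (4 + k) * γ (2 + k) (suc i) + (1 + k) * γ k (suc i)
                       ≡ (5 + 2 * k) * γ (1 + k) (suc i) + 4 * (1 + k) * γ k i
  γ-recurrence k i with k <? 2 * i
  ... | yes k<2i = begin
    (4 + k) * γ (2 + k) (suc i) + (1 + k) * γ k (suc i)  ≡⟨ cong₂ (λ x y → (4 + k) * x + (1 + k) * y) γ₂≡0 γ₀≡0 ⟩
    (4 + k) * 0 + (1 + k) * 0                             ≡⟨ zeros (4 + k) (1 + k) (5 + 2 * k) (4 * (1 + k)) ⟩
    (5 + 2 * k) * 0 + 4 * (1 + k) * 0                     ≡⟨ cong₂ (λ x y → (5 + 2 * k) * x + 4 * (1 + k) * y) γ₁≡0 (γ-vanishes i k<2i) ⟨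
    (5 + 2 * k) * γ (1 + k) (suc i) + 4 * (1 + k) * γ k i ∎
    where
    k≤1+2i : k ≤ 1 + 2 * i
    k≤1+2i = ≤-trans (n≤1+n k) (≤-trans k<2i (n≤1+n _))
    γ₂≡0 = γ-vanishes (suc i) (m≤1+2i⇒m<2[1+i] i (s≤s k<2i))
    γ₁≡0 = γ-vanishes (suc i) (m≤1+2i⇒m<2[1+i] i (≤-trans k<2i (n≤1+n _)))
    γ₀≡0 = γ-vanishes (suc i) (m≤1+2i⇒m<2[1+i] i k≤1+2i)
    zeros : ∀ a b c d → a * 0 + b * 0 ≡ c * 0 + d * 0
    zeros = solve-∀
  ... | no k≮2i = *-cancelʳ-≡ _ _ P (+-cancelʳ-≡ e _ _ (begin
    ((4 + k) * γ₂ + (1 + k) * γ₀) * P + e         ≡⟨ expand (4 + k) (1 + k) γ₂ γ₀ P r g ⟩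
    (4 + k) * (γ₂ * P) + (1 + k) * (γ₀ * P + r * g)   ≡⟨ cong₂ (λ x y → (4 + k) * x + (1 + k) * y) (γ-ratio₂ i r eq) (γ-ratio₀ i r eq) ⟩
    (4 + k) * ((2 + k) * (1 + k) * g) + (1 + k) * (r * r * g)
        ≡⟨ subst (λ k → (4 + k) * ((2 + k) * (1 + k) * g) + (1 + k) * (r * r * g)
                      ≡ (5 + 2 * k) * ((1 + k) * r * g) + 4 * (1 + k) * g * P + (1 + k) * (r * g)) eq (identity i r g) ⟩
    (5 + 2 * k) * ((1 + k) * r * g) + 4 * (1 + k) * g * P + e   ≡⟨ cong (λ x → (5 + 2 * k) * x + 4 * (1 + k) * g * P + e) (γ-ratio₁ i r eq) ⟨
    (5 + 2 * k) * (γ₁ * P) + 4 * (1 + k) * g * P + e           ≡⟨ collect (5 + 2 * k) (4 * (1 + k)) γ₁ g P e ⟩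
    ((5 + 2 * k) * γ₁ + 4 * (1 + k) * g) * P + e              ∎))
    where
    r = k ∸ 2 * i
    eq : 2 * i + r ≡ k
    eq = m+[n∸m]≡n (≮⇒≥ k≮2i)
    P = (1 + i) * (2 + i)
    instance _ = m*n≢0 (1 + i) (2 + i)
    γ₂ = γ (2 + k) (suc i)
    γ₁ = γ (1 + k) (suc i)
    γ₀ = γ k (suc i)
    g = γ k i
    e = (1 + k) * (r * g)
    expand : ∀ a b x y p r g → (a * x + b * y) * p + b * (r * g) ≡ a * (x * p) + b * (y * p + r * g)
    expand = solve-∀
    identity : ∀ i r g → (4 + (2 * i + r)) * ((2 + (2 * i + r)) * (1 + (2 * i + r)) * g) + (1 + (2 * i + r)) * (r * r * g)
                       ≡ (5 + 2 * (2 * i + r)) * ((1 + (2 * i + r)) * r * g) + 4 * (1 + (2 * i + r)) * g * ((1 + i) * (2 + i))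
                         + (1 + (2 * i + r)) * (r * g)
    identity = solve-∀
    collect : ∀ a b x g p e → a * (x * p) + b * g * p + e ≡ (a * x + b * g) * p + e
    collect = solve-∀

  γ-recurrence₀ : ∀ k → (4 + k) * γ (2 + k) 0 + (1 + k) * γ k 0 ≡ (5 + 2 * k) * γ (1 + k) 0
  γ-recurrence₀ k = identity k
    where
    identity : ∀ k → (4 + k) * 1 + (1 + k) * 1 ≡ (5 + 2 * k) * 1
    identity = solve-∀

  coeff≡m*γ : ∀ m j → coeff (2 + m) (suc j) ≡ m * γ m j
  coeff≡m*γ m j = begin
    (m * ((2 * j) C j) * c) / suc j             ≡⟨ cong (λ x → (m * x * c) / suc j) (catalan*[1+j]≡[2j]Cj j) ⟨
    (m * (catalan j * suc j) * c) / suc j       ≡⟨ cong (_/ suc j) (reassoc m (catalan j) (suc j) c) ⟩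
    (m * (c * catalan j) * suc j) / suc j       ≡⟨ m*n/n≡m (m * γ m j) (suc j) ⟩
    m * γ m j                                   ∎
    where
    c = m C (2 * j)
    reassoc : ∀ m t s c → m * (t * s) * c ≡ m * (c * t) * s
    reassoc = solve-∀

module IntegerCoefficients {c ℓ} (R : CommutativeRing c ℓ) where

  open import Data.Integer as ℤ using (ℤ; +_; -[1+_]; sign; ∣_∣)
  import Data.Integer.Properties as ℤ
  import Data.Sign as Sign
  open import Data.Maybe using (Maybe; map)
  open import Relation.Binary.Consequences using (dec⇒weaklyDec)
  open import Algebra.Solver.Ring.AlmostCommutativeRing using (fromCommutativeRing; _-Raw-AlmostCommutative⟶_)
  import Algebra.Solver.Ring
  open CommutativeRing R
  open import Algebra.Properties.Ring ring using (-0#≈0#; -‿involutive; -‿+-comm; -1*x≈-x)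
  open import Algebra.Properties.Semiring.Mult.TCOptimised semiring using (_×_; 1+×; ×-homo-+; ×1-homo-*)
  open import Algebra.Properties.CommutativeSemigroup +-commutativeSemigroup using (interchange)
  open import Relation.Binary.Reasoning.Setoid setoid

  -- The type-checking optimised multiplication makes ι 0 and ι 1 reduce to 0# and 1#, so that
  -- solver constants agree definitionally with the ring's own 0# and 1#.
  ι : ℕ → Carrier
  ι n = n × 1#

  ι-linear : ∀ a b c d → ι (a ℕ.* c ℕ.+ b ℕ.* d) ≈ ι a * ι c + ι b * ι d
  ι-linear a b c d = trans (×-homo-+ 1# (a ℕ.* c) (b ℕ.* d)) (+-cong (×1-homo-* a c) (×1-homo-* b d))

  ⟦_⟧ℤ : ℤ → Carrier
  ⟦ + n      ⟧ℤ = ι n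
  ⟦ -[1+ n ] ⟧ℤ = - ι (suc n)

  private
    ⟦_⟧ₛ : Sign.Sign → Carrier
    ⟦ Sign.+ ⟧ₛ = 1#
    ⟦ Sign.- ⟧ₛ = - 1#

    x+-0#≈x : ∀ x → x + - 0# ≈ x
    x+-0#≈x x = trans (+-congˡ -0#≈0#) (+-identityʳ x)

    [1+x]-[1+y]≈x-y : ∀ x y → (1# + x) + - (1# + y) ≈ x + - y
    [1+x]-[1+y]≈x-y x y = begin
      (1# + x) + - (1# + y)     ≈⟨ +-congˡ (-‿+-comm 1# y) ⟨
      (1# + x) + (- 1# + - y)   ≈⟨ interchange 1# x (- 1#) (- y) ⟩
      (1# + - 1#) + (x + - y)   ≈⟨ +-congʳ (-‿inverseʳ 1#) ⟩
      0# + (x + - y)            ≈⟨ +-identityˡ (x + - y) ⟩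
      x + - y                   ∎

    ⊖-homo : ∀ m n → ⟦ m ℤ.⊖ n ⟧ℤ ≈ ι m + - ι n
    ⊖-homo zero    zero    = sym (x+-0#≈x 0#)
    ⊖-homo (suc m) zero    = sym (x+-0#≈x (ι (suc m)))
    ⊖-homo zero    (suc n) = sym (+-identityˡ _)
    ⊖-homo (suc m) (suc n) = begin
      ⟦ suc m ℤ.⊖ suc n ⟧ℤ              ≡⟨ ≡.cong ⟦_⟧ℤ (ℤ.[1+m]⊖[1+n]≡m⊖n m n) ⟩
      ⟦ m ℤ.⊖ n ⟧ℤ                      ≈⟨ ⊖-homo m n ⟩
      ι m + - ι n                       ≈⟨ [1+x]-[1+y]≈x-y (ι m) (ι n) ⟨
      (1# + ι m) + - (1# + ι n)         ≈⟨ +-cong (1+× m 1#) (-‿cong (1+× n 1#)) ⟨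
      ι (suc m) + - ι (suc n)           ∎

    +-homo : ∀ i j → ⟦ i ℤ.+ j ⟧ℤ ≈ ⟦ i ⟧ℤ + ⟦ j ⟧ℤ
    +-homo (+ m)    (+ n)    = ×-homo-+ 1# m n
    +-homo (+ m)    -[1+ n ] = ⊖-homo m (suc n)
    +-homo -[1+ m ] (+ n)    = trans (⊖-homo n (suc m)) (+-comm _ _)
    +-homo -[1+ m ] -[1+ n ] = begin
      - ι (suc (suc (m ℕ.+ n)))      ≡⟨ ≡.cong (λ k → - ι k) (ℕ.+-suc (suc m) n) ⟨
      - ι (suc m ℕ.+ suc n)          ≈⟨ -‿cong (×-homo-+ 1# (suc m) (suc n)) ⟩
      - (ι (suc m) + ι (suc n))      ≈⟨ -‿+-comm _ _ ⟨
      - ι (suc m) + - ι (suc n)      ∎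

    ◃-homo : ∀ s n → ⟦ s ℤ.◃ n ⟧ℤ ≈ ⟦ s ⟧ₛ * ι n
    ◃-homo s        zero    = sym (zeroʳ ⟦ s ⟧ₛ)
    ◃-homo Sign.+ (suc n) = sym (*-identityˡ _)
    ◃-homo Sign.- (suc n) = sym (-1*x≈-x _)

    sign-abs : ∀ i → ⟦ i ⟧ℤ ≈ ⟦ sign i ⟧ₛ * ι ∣ i ∣
    sign-abs (+ n)    = sym (*-identityˡ _)
    sign-abs -[1+ n ] = sym (-1*x≈-x _)

    sign-homo : ∀ s t → ⟦ s Sign.* t ⟧ₛ ≈ ⟦ s ⟧ₛ * ⟦ t ⟧ₛ
    sign-homo Sign.+ t      = sym (*-identityˡ _)
    sign-homo Sign.- Sign.+ = sym (*-identityʳ _)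
    sign-homo Sign.- Sign.- = sym (trans (-1*x≈-x (- 1#)) (-‿involutive 1#))

    *-homo : ∀ i j → ⟦ i ℤ.* j ⟧ℤ ≈ ⟦ i ⟧ℤ * ⟦ j ⟧ℤ
    *-homo i j = begin
      ⟦ (sign i Sign.* sign j) ℤ.◃ (∣ i ∣ ℕ.* ∣ j ∣) ⟧ℤ      ≈⟨ ◃-homo (sign i Sign.* sign j) (∣ i ∣ ℕ.* ∣ j ∣) ⟩
      ⟦ sign i Sign.* sign j ⟧ₛ * ι (∣ i ∣ ℕ.* ∣ j ∣)         ≈⟨ *-cong (sign-homo (sign i) (sign j)) (×1-homo-* ∣ i ∣ ∣ j ∣) ⟩
      (⟦ sign i ⟧ₛ * ⟦ sign j ⟧ₛ) * (ι ∣ i ∣ * ι ∣ j ∣)       ≈⟨ *-interchange _ _ _ _ ⟩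
      (⟦ sign i ⟧ₛ * ι ∣ i ∣) * (⟦ sign j ⟧ₛ * ι ∣ j ∣)       ≈⟨ *-cong (sign-abs i) (sign-abs j) ⟨
      ⟦ i ⟧ℤ * ⟦ j ⟧ℤ                                       ∎
      where
      open import Algebra.Properties.CommutativeSemigroup *-commutativeSemigroup using () renaming (interchange to *-interchange)

    -‿homo : ∀ i → ⟦ ℤ.- i ⟧ℤ ≈ - ⟦ i ⟧ℤ
    -‿homo (+ zero)  = sym -0#≈0#
    -‿homo (+ suc n) = refl
    -‿homo -[1+ n ]  = sym (-‿involutive _)

    ℤ-morphism : ℤ.+-*-rawRing -Raw-AlmostCommutative⟶ fromCommutativeRing R
    ℤ-morphism = record
      { ⟦_⟧ = ⟦_⟧ℤ ; +-homo = +-homo ; *-homo = *-homo ; -‿homo = -‿homo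
      ; 0-homo = refl ; 1-homo = refl }

    ⟦⟧-≟ : ∀ i j → Maybe (⟦ i ⟧ℤ ≈ ⟦ j ⟧ℤ)
    ⟦⟧-≟ i j = map (λ { ≡.refl → refl }) (dec⇒weaklyDec ℤ._≟_ i j)

  open Algebra.Solver.Ring ℤ.+-*-rawRing (fromCommutativeRing R) ℤ-morphism ⟦⟧-≟ public

module Sums {c ℓ} (R : CommutativeRing c ℓ) where

  open CommutativeRing R
  open import Relation.Binary.Reasoning.Setoid setoid
  open import Algebra.Properties.CommutativeSemigroup +-commutativeSemigroup using (interchange)

  ∑< : ℕ → (ℕ → Carrier) → Carrier
  ∑< zero    f = 0#
  ∑< (suc K) f = ∑< K f + f K

  syntax ∑< K (λ j → e) = ∑[ j < K ] e

  ∑-cong : ∀ K {f g} → (∀ j → f j ≈ g j) → ∑< K f ≈ ∑< K g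
  ∑-cong zero    f≈g = refl
  ∑-cong (suc K) f≈g = +-cong (∑-cong K f≈g) (f≈g K)

  ∑-linear : ∀ K a b f g → ∑[ j < K ] (a * f j + b * g j) ≈ a * ∑< K f + b * ∑< K g
  ∑-linear zero    a b f g = sym (trans (+-cong (zeroʳ a) (zeroʳ b)) (+-identityʳ 0#))
  ∑-linear (suc K) a b f g = begin
    ∑[ j < K ] (a * f j + b * g j) + (a * f K + b * g K)   ≈⟨ +-congʳ (∑-linear K a b f g) ⟩
    (a * ∑< K f + b * ∑< K g) + (a * f K + b * g K)        ≈⟨ interchange _ _ _ _ ⟩
    (a * ∑< K f + a * f K) + (b * ∑< K g + b * g K)        ≈⟨ +-cong (distribˡ a _ _) (distribˡ b _ _) ⟨
    a * ∑< (suc K) f + b * ∑< (suc K) g                   ∎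

  ∑-distribˡ : ∀ K a f → ∑[ j < K ] (a * f j) ≈ a * ∑< K f
  ∑-distribˡ zero    a f = sym (zeroʳ a)
  ∑-distribˡ (suc K) a f = trans (+-congʳ (∑-distribˡ K a f)) (sym (distribˡ a _ _))

  ∑-zero : ∀ K {f} → (∀ j → f j ≈ 0#) → ∑< K f ≈ 0#
  ∑-zero zero    f≈0 = refl
  ∑-zero (suc K) f≈0 = trans (+-cong (∑-zero K f≈0) (f≈0 K)) (+-identityʳ 0#)

  ∑-head : ∀ K f → ∑< (suc K) f ≈ f 0 + ∑[ j < K ] f (suc j)
  ∑-head zero    f = trans (+-identityˡ (f 0)) (sym (+-identityʳ (f 0)))
  ∑-head (suc K) f = trans (+-congʳ (∑-head K f)) (+-assoc _ _ _)

  ∑-extend : ∀ {K K′} f → K ℕ.≤ K′ → (∀ j → K ℕ.≤ j → f j ≈ 0#) → ∑< K′ f ≈ ∑< K f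
  ∑-extend {K} {K′} f K≤K′ f≈0 = begin
    ∑< K′ f               ≡⟨ ≡.cong (λ n → ∑< n f) (ℕ.m∸n+n≡m K≤K′) ⟨
    ∑< (K′ ℕ.∸ K ℕ.+ K) f ≈⟨ ∑-tail K (K′ ℕ.∸ K) f f≈0 ⟩
    ∑< K f                ∎
    where
    ∑-tail : ∀ K d f → (∀ j → K ℕ.≤ j → f j ≈ 0#) → ∑< (d ℕ.+ K) f ≈ ∑< K f
    ∑-tail K zero    f f≈0 = refl
    ∑-tail K (suc d) f f≈0 = trans (+-cong (∑-tail K d f f≈0) (f≈0 _ (ℕ.m≤n+m K d))) (+-identityʳ _)

module NarayanaPolynomials {c ℓ} (R : CommutativeRing c ℓ) where

  open CommutativeRing R
  open import Data.Nat as ℕ using (_∸_; _≤_; ⌊_/2⌋; s≤s)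
  open import Data.Sum using (_⊎_; inj₁; inj₂)
  open import Relation.Nullary using (yes; no)
  open import Algebra.Definitions.RawSemiring (Semiring.rawSemiring semiring) using (_^_)
  open import Algebra.Properties.Semiring.Mult.TCOptimised semiring using (×1-homo-*)
  open import Relation.Binary.Reasoning.Setoid setoid
  open IntegerCoefficients R using (ι; ι-linear; solve; _:=_; _:+_; _:*_; _:-_; con)
  open Sums R

  basis : Carrier → ℕ → ℕ → Carrier
  basis x m j = x ^ j * (1# + x) ^ (m ∸ 2 ℕ.* j)

  term : ℕ → Carrier → ℕ → Carrier
  term m x j = ι (γ m j) * basis x m j

  narayana : ℕ → Carrier → Carrier
  narayana m x = ∑< (suc ⌊ m /2⌋) (term m x)

  private
    γ-support : ∀ m j → 2 ℕ.* j ≤ m ⊎ γ m j ≡ 0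
    γ-support m j with 2 ℕ.* j ℕ.≤? m
    ... | yes 2j≤m = inj₁ 2j≤m
    ... | no  2j≰m = inj₂ (γ-vanishes j (ℕ.≰⇒> 2j≰m))

    support-suc : ∀ {m} j {c} → 2 ℕ.* j ≤ m ⊎ c ≡ 0 → 2 ℕ.* j ≤ suc m ⊎ c ≡ 0
    support-suc j (inj₁ 2j≤m) = inj₁ (ℕ.m≤n⇒m≤1+n 2j≤m)
    support-suc j (inj₂ c≡0)= inj₂ c≡0

  [1+x]*[ιc*basis] : ∀ x {c} m j → 2 ℕ.* j ≤ m ⊎ c ≡ 0 → (1# + x) * (ι c * basis x m j) ≈ ι c * basis x (suc m) j
  [1+x]*[ιc*basis] x {c} m j (inj₁ 2j≤m) = begin
    (1# + x) * (ι c * (x ^ j * (1# + x) ^ (m ∸ 2 ℕ.* j)))   ≈⟨ solve 4 (λ u a p q → u :* (a :* (p :* q)) := a :* (p :* (u :* q))) refl (1# + x) (ι c) (x ^ j) _ ⟩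
    ι c * (x ^ j * (1# + x) ^ suc (m ∸ 2 ℕ.* j))           ≡⟨ ≡.cong (λ e → ι c * (x ^ j * (1# + x) ^ e)) (ℕ.+-∸-assoc 1 2j≤m) ⟨
    ι c * (x ^ j * (1# + x) ^ (suc m ∸ 2 ℕ.* j))           ∎
  [1+x]*[ιc*basis] x m j (inj₂ ≡.refl) = solve 3 (λ u p q → u :* (con (+ 0) :* p) := con (+ 0) :* q) refl (1# + x) _ _

  x*basis : ∀ x m i → x * basis x m i ≈ basis x (2 ℕ.+ m) (suc i)
  x*basis x m i = begin
    x * (x ^ i * (1# + x) ^ (m ∸ 2 ℕ.* i))                ≈⟨ *-assoc x (x ^ i) _ ⟨
    x ^ suc i * (1# + x) ^ (m ∸ 2 ℕ.* i)                  ≡⟨ ≡.cong (λ e → x ^ suc i * (1# + x) ^ (suc m ∸ e)) (ℕ.+-suc i (i ℕ.+ 0)) ⟨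
    x ^ suc i * (1# + x) ^ (2 ℕ.+ m ∸ 2 ℕ.* suc i)        ∎

  ι-combination : ∀ a b c d y → ι a * (ι c * y) + ι b * (ι d * y) ≈ ι (a ℕ.* c ℕ.+ b ℕ.* d) * y
  ι-combination a b c d y = begin
    ι a * (ι c * y) + ι b * (ι d * y)   ≈⟨ solve 5 (λ a b c d y → a :* (c :* y) :+ b :* (d :* y) := (a :* c :+ b :* d) :* y) refl (ι a) (ι b) (ι c) (ι d) y ⟩
    (ι a * ι c + ι b * ι d) * y         ≈⟨ *-congʳ (ι-linear a b c d) ⟨
    ι (a ℕ.* c ℕ.+ b ℕ.* d) * y         ∎

  previous-term : ℕ → Carrier → ℕ → Carrier
  previous-term k x zero    = 0#
  previous-term k x (suc i) = term k x i

  term-recurrence : ∀ x k j →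
      ι (4 ℕ.+ k) * term (2 ℕ.+ k) x j + ι (1 ℕ.+ k) * ((1# + x) * ((1# + x) * term k x j))
    ≈ ι (5 ℕ.+ 2 ℕ.* k) * ((1# + x) * term (1 ℕ.+ k) x j) + ι (4 ℕ.* (1 ℕ.+ k)) * (x * previous-term k x j)
  term-recurrence x k j = begin
    ι a * (ι γ₂ * B) + ι b * (u * (u * (ι γ₀ * basis x k j)))
      ≈⟨ +-congˡ (*-congˡ (trans (*-congˡ ([1+x]*[ιc*basis] x k j (γ-support k j))) ([1+x]*[ιc*basis] x (suc k) j (support-suc j (γ-support k j))))) ⟩
    ι a * (ι γ₂ * B) + ι b * (ι γ₀ * B)         ≈⟨ ι-combination a b γ₂ γ₀ B ⟩
    ι (a ℕ.* γ₂ ℕ.+ b ℕ.* γ₀) * B               ≡⟨ ≡.cong (λ n → ι n * B) (γ-recurrence-at j) ⟩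
    ι (c′ ℕ.* γ₁ ℕ.+ d ℕ.* γ₋ j) * B            ≈⟨ ι-combination c′ d γ₁ (γ₋ j) B ⟨
    ι c′ * (ι γ₁ * B) + ι d * (ι (γ₋ j) * B)
      ≈⟨ +-cong (*-congˡ ([1+x]*[ιc*basis] x (suc k) j (γ-support (suc k) j))) (*-congˡ (x*previous-term j)) ⟨
    ι c′ * (u * term (1 ℕ.+ k) x j) + ι d * (x * previous-term k x j)   ∎
    where
    u = 1# + x
    a = 4 ℕ.+ k
    b = 1 ℕ.+ k
    c′ = 5 ℕ.+ 2 ℕ.* k
    d = 4 ℕ.* (1 ℕ.+ k)
    γ₂ = γ (2 ℕ.+ k) j
    γ₁ = γ (1 ℕ.+ k) j
    γ₀ = γ k j
    B = basis x (2 ℕ.+ k) j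
    γ₋ : ℕ → ℕ
    γ₋ zero    = 0
    γ₋ (suc i) = γ k i
    γ-recurrence-at : ∀ j → a ℕ.* γ (2 ℕ.+ k) j ℕ.+ b ℕ.* γ k j ≡ c′ ℕ.* γ (1 ℕ.+ k) j ℕ.+ d ℕ.* γ₋ j
    γ-recurrence-at zero    = ≡.trans (γ-recurrence₀ k) (≡.sym (≡.trans (≡.cong (c′ ℕ.* 1 ℕ.+_) (ℕ.*-zeroʳ d)) (ℕ.+-identityʳ _)))
    γ-recurrence-at (suc i) = γ-recurrence k i
    x*previous-term : ∀ j → x * previous-term k x j ≈ ι (γ₋ j) * basis x (2 ℕ.+ k) j
    x*previous-term zero    = trans (zeroʳ x) (sym (zeroˡ _))
    x*previous-term (suc i) = trans (x∙yz≈y∙xz x (ι (γ k i)) _) (*-congˡ (x*basis x k i))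
      where open import Algebra.Properties.CommutativeSemigroup *-commutativeSemigroup using (x∙yz≈y∙xz)

  term-vanishes : ∀ m x j → suc ⌊ m /2⌋ ≤ j → term m x j ≈ 0#
  term-vanishes m x j ⌊m/2⌋<j = trans (*-congʳ (reflexive (≡.cong ι (γ-vanishes j m<2j)))) (zeroˡ _)
    where m<2j = ℕ.<-≤-trans (m<2*[1+⌊m/2⌋] m) (ℕ.*-monoʳ-≤ 2 ⌊m/2⌋<j)

  -- Coefficientwise in the basis xʲ (1+x)^(k+2-2j) this is γ-recurrence.
  narayana-recurrence⁺ : ∀ x k →
      ι (4 ℕ.+ k) * narayana (2 ℕ.+ k) x + ι (1 ℕ.+ k) * ((1# + x) * ((1# + x) * narayana k x))
    ≈ ι (5 ℕ.+ 2 ℕ.* k) * ((1# + x) * narayana (1 ℕ.+ k) x) + ι (4 ℕ.* (1 ℕ.+ k)) * (x * narayana k x)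
  narayana-recurrence⁺ x k = begin
    ι a * narayana (2 ℕ.+ k) x + ι b * (u * (u * narayana k x))
      ≈⟨ +-congˡ (*-congˡ (trans (*-congˡ (trans (*-congˡ N₀≈) (sym (∑-distribˡ K u T₀)))) (sym (∑-distribˡ K u (λ j → u * T₀ j))))) ⟩
    ι a * ∑< K T₂ + ι b * ∑[ j < K ] (u * (u * T₀ j))                 ≈⟨ ∑-linear K (ι a) (ι b) T₂ (λ j → u * (u * T₀ j)) ⟨
    ∑[ j < K ] (ι a * T₂ j + ι b * (u * (u * T₀ j)))                  ≈⟨ ∑-cong K (term-recurrence x k) ⟩
    ∑[ j < K ] (ι c′ * (u * T₁ j) + ι d * (x * previous-term k x j))        ≈⟨ ∑-linear K (ι c′) (ι d) (λ j → u * T₁ j) (λ j → x * previous-term k x j) ⟩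
    ι c′ * ∑[ j < K ] (u * T₁ j) + ι d * ∑[ j < K ] (x * previous-term k x j)
      ≈⟨ +-cong (*-congˡ (trans (∑-distribˡ K u T₁) (*-congˡ N₁≈))) (*-congˡ (trans (∑-distribˡ K x (previous-term k x)) (*-congˡ N₀≈′))) ⟩
    ι c′ * (u * narayana (1 ℕ.+ k) x) + ι d * (x * narayana k x)      ∎
    where
    u = 1# + x
    a = 4 ℕ.+ k
    b = 1 ℕ.+ k
    c′ = 5 ℕ.+ 2 ℕ.* k
    d = 4 ℕ.* (1 ℕ.+ k)
    K = suc (suc ⌊ k /2⌋)
    T₂ = term (2 ℕ.+ k) x
    T₁ = term (1 ℕ.+ k) x
    T₀ = term k x
    N₀≈ : narayana k x ≈ ∑< K T₀
    N₀≈ = sym (∑-extend T₀ (ℕ.n≤1+n _) (term-vanishes k x))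
    N₁≈ : ∑< K T₁ ≈ narayana (1 ℕ.+ k) x
    N₁≈ = ∑-extend T₁ (s≤s (ℕ.⌊n/2⌋-mono (ℕ.n≤1+n (suc k)))) (term-vanishes (1 ℕ.+ k) x)
    N₀≈′ : ∑< K (previous-term k x) ≈ narayana k x
    N₀≈′ = trans (∑-head (suc ⌊ k /2⌋) (previous-term k x)) (+-identityˡ _)

  narayana-recurrence : ∀ x k →
      ι (4 ℕ.+ k) * narayana (2 ℕ.+ k) x
    ≈ ι (5 ℕ.+ 2 ℕ.* k) * ((1# + x) * narayana (1 ℕ.+ k) x) - ι (1 ℕ.+ k) * ((1# - x) * ((1# - x) * narayana k x))
  narayana-recurrence x k = begin
    α * X                                          ≈⟨ solve 5 (λ α X γ u W → α :* X := (α :* X :+ γ :* (u :* (u :* W))) :- γ :* (u :* (u :* W))) refl α X γ′ u W ⟩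
    (α * X + γ′ * (u * (u * W))) - γ′ * (u * (u * W))  ≈⟨ +-congʳ (narayana-recurrence⁺ x k) ⟩
    (β * (u * Y) + ι (4 ℕ.* (1 ℕ.+ k)) * (x * W)) - γ′ * (u * (u * W))   ≈⟨ +-congʳ (+-congˡ (*-congʳ (×1-homo-* 4 (1 ℕ.+ k)))) ⟩
    (β * (u * Y) + (ι 4 * γ′) * (x * W)) - γ′ * (u * (u * W))
      ≈⟨ solve 5 (λ β Y γ x W → (β :* ((con (+ 1) :+ x) :* Y) :+ (con (+ 4) :* γ) :* (x :* W)) :- γ :* ((con (+ 1) :+ x) :* ((con (+ 1) :+ x) :* W))
                              := β :* ((con (+ 1) :+ x) :* Y) :- γ :* ((con (+ 1) :- x) :* ((con (+ 1) :- x) :* W))) refl β Y γ′ x W ⟩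
    β * (u * Y) - γ′ * ((1# - x) * ((1# - x) * W))  ∎
    where
    u = 1# + x
    α = ι (4 ℕ.+ k)
    β = ι (5 ℕ.+ 2 ℕ.* k)
    γ′ = ι (1 ℕ.+ k)
    X = narayana (2 ℕ.+ k) x
    Y = narayana (1 ℕ.+ k) x
    W = narayana k x

  1^n≈1 : ∀ n → 1# ^ n ≈ 1#
  1^n≈1 zero    = refl
  1^n≈1 (suc n) = trans (*-identityˡ _) (1^n≈1 n)

  narayana-at-0 : ∀ m → narayana m 0# ≈ 1#
  narayana-at-0 m = begin
    narayana m 0#                                       ≈⟨ ∑-head ⌊ m /2⌋ (term m 0#) ⟩
    term m 0# 0 + ∑[ j < ⌊ m /2⌋ ] term m 0# (suc j)     ≈⟨ +-cong constant-term (∑-zero ⌊ m /2⌋ higher-terms) ⟩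
    1# + 0#                                             ≈⟨ +-identityʳ 1# ⟩
    1#                                                  ∎
    where
    constant-term : term m 0# 0 ≈ 1#
    constant-term = trans (*-identityˡ _) (trans (*-identityˡ _) (trans (^-congˡ m (+-identityʳ 1#)) (1^n≈1 m)))
      where open import Algebra.Properties.Semiring.Exp semiring using (^-congˡ)
    higher-terms : ∀ j → term m 0# (suc j) ≈ 0#
    higher-terms j = trans (*-congˡ (trans (*-congʳ (zeroˡ _)) (zeroˡ _))) (zeroʳ _)

  narayana₀ : ∀ x → narayana 0 x ≈ 1#
  narayana₀ x = solve 0 (con (+ 0) :+ con (+ 1) :* (con (+ 1) :* con (+ 1)) := con (+ 1)) refl

  narayana₁ : ∀ x → narayana 1 x ≈ 1# + x
  narayana₁ x = solve 1 (λ x → con (+ 0) :+ con (+ 1) :* (con (+ 1) :* ((con (+ 1) :+ x) :* con (+ 1))) := con (+ 1) :+ x) refl x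

  narayana-recurrence-at-1 : ∀ k → ι (4 ℕ.+ k) * narayana (2 ℕ.+ k) 1# ≈ ι (5 ℕ.+ 2 ℕ.* k) * ((1# + 1#) * narayana (1 ℕ.+ k) 1#)
  narayana-recurrence-at-1 k = trans (narayana-recurrence 1# k)
    (solve 4 (λ β Y γ W → β :* ((con (+ 1) :+ con (+ 1)) :* Y) :- γ :* ((con (+ 1) :- con (+ 1)) :* ((con (+ 1) :- con (+ 1)) :* W))
                        := β :* ((con (+ 1) :+ con (+ 1)) :* Y)) refl _ _ _ _)

module Reals (R : RealNumbers) where

  open RealNumbers R

  ℝ-ring : CommutativeRing _ _
  ℝ-ring = record { isCommutativeRing = isCommutativeRing }

  open CommutativeRing ℝ-ring using (+-comm; +-identityˡ; +-identityʳ; *-identityˡ; *-comm; *-assoc; -‿inverseʳ; zeroʳ)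
  open import Algebra.Properties.Ring (CommutativeRing.ring ℝ-ring) using (-‿distribˡ-*; -‿distribʳ-*; -‿involutive)
  open IntegerCoefficients ℝ-ring public using () renaming (ι to ιᴿ)
  open import Relation.Binary.Structures using (IsTotalOrder)
  open IsTotalOrder isTotalOrder using (antisym; total) renaming (trans to ≤-trans; reflexive to ≤-reflexive)
  open import Data.Empty using (⊥-elim)
  open import Data.Product using (proj₁; proj₂)
  open import Data.Sum using (inj₁; inj₂)
  open import Relation.Nullary using (¬_)
  open import Relation.Binary.PropositionalEquality using (refl; cong; sym; trans; subst; subst₂)
  open import Relation.Binary.PropositionalEquality.Properties using (module ≡-Reasoning)
  open ≡-Reasoning

  x≤0⇒0≤-x : ∀ {x} → x ≤ 0# → 0# ≤ - x
  x≤0⇒0≤-x {x} x≤0 = subst₂ _≤_ (-‿inverseʳ x) (+-identityˡ (- x)) (+-mono-≤ x 0# (- x) x≤0)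

  0≤x*x : ∀ x → 0# ≤ x * x
  0≤x*x x with total 0# x
  ... | inj₁ 0≤x = *-nonneg x x 0≤x 0≤x
  ... | inj₂ x≤0 = subst (0# ≤_) -x*-x≡x*x (*-nonneg (- x) (- x) (x≤0⇒0≤-x x≤0) (x≤0⇒0≤-x x≤0))
    where
    -x*-x≡x*x : - x * - x ≡ x * x
    -x*-x≡x*x = trans (sym (-‿distribˡ-* x (- x))) (trans (cong -_ (sym (-‿distribʳ-* x x))) (-‿involutive (x * x)))

  0≤x⇒0≤y⇒0≤x+y : ∀ {x y} → 0# ≤ x → 0# ≤ y → 0# ≤ x + y
  0≤x⇒0≤y⇒0≤x+y {x} {y} 0≤x 0≤y = ≤-trans 0≤y (subst (_≤ x + y) (+-identityˡ y) (+-mono-≤ 0# x y 0≤x))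

  nonneg-sum≡0⇒≡0ˡ : ∀ {x y} → 0# ≤ x → 0# ≤ y → x + y ≡ 0# → x ≡ 0#
  nonneg-sum≡0⇒≡0ˡ {x} {y} 0≤x 0≤y x+y≡0 =
    antisym (subst₂ _≤_ (+-identityˡ x) (trans (+-comm y x) x+y≡0) (+-mono-≤ 0# y x 0≤y)) 0≤x

  nonneg-sum≡0⇒≡0ʳ : ∀ {x y} → 0# ≤ x → 0# ≤ y → x + y ≡ 0# → y ≡ 0#
  nonneg-sum≡0⇒≡0ʳ {x} {y} 0≤x 0≤y x+y≡0 = nonneg-sum≡0⇒≡0ˡ 0≤y 0≤x (trans (+-comm y x) x+y≡0)

  0≤1 : 0# ≤ 1#
  0≤1 = subst (0# ≤_) (*-identityˡ 1#) (0≤x*x 1#)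

  0≤ιᴿ : ∀ n → 0# ≤ ιᴿ n
  0≤ιᴿ zero          = ≤-reflexive refl
  0≤ιᴿ (suc zero)    = 0≤1
  0≤ιᴿ (suc (suc n)) = 0≤x⇒0≤y⇒0≤x+y (0≤ιᴿ (suc n)) 0≤1

  ιᴿ[1+n]≢0 : ∀ n → ¬ ιᴿ (suc n) ≡ 0#
  ιᴿ[1+n]≢0 zero    1≡0 = 0≢1 (sym 1≡0)
  ιᴿ[1+n]≢0 (suc n) e   = 0≢1 (sym (nonneg-sum≡0⇒≡0ʳ (0≤ιᴿ (suc n)) 0≤1 e))

  inv : ∀ x → ¬ x ≡ 0# → Carrier
  inv x x≢0 = proj₁ (inverse x x≢0)

  x*y≡z⇒y≡x⁻¹*z : ∀ {x y z} (x≢0 : ¬ x ≡ 0#) → x * y ≡ z → y ≡ inv x x≢0 * z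
  x*y≡z⇒y≡x⁻¹*z {x} {y} {z} x≢0 x*y≡z = begin
    y                       ≡⟨ *-identityˡ y ⟨
    1# * y                  ≡⟨ cong (_* y) (proj₂ (inverse x x≢0)) ⟨
    (x * inv x x≢0) * y     ≡⟨ cong (_* y) (*-comm x _) ⟩
    (inv x x≢0 * x) * y     ≡⟨ *-assoc _ x y ⟩
    inv x x≢0 * (x * y)     ≡⟨ cong (inv x x≢0 *_) x*y≡z ⟩
    inv x x≢0 * z           ∎

  x≢0⇒x*y≡0⇒y≡0 : ∀ {x y} → ¬ x ≡ 0# → x * y ≡ 0# → y ≡ 0#
  x≢0⇒x*y≡0⇒y≡0 x≢0 x*y≡0 = trans (x*y≡z⇒y≡x⁻¹*z x≢0 x*y≡0) (zeroʳ _)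

  *-≢0 : ∀ {x y} → ¬ x ≡ 0# → ¬ y ≡ 0# → ¬ x * y ≡ 0#
  *-≢0 x≢0 y≢0 x*y≡0 = y≢0 (x≢0⇒x*y≡0⇒y≡0 x≢0 x*y≡0)

  x*x≡0⇒¬¬x≡0 : ∀ {x} → x * x ≡ 0# → ¬ ¬ x ≡ 0#
  x*x≡0⇒¬¬x≡0 x*x≡0 x≢0 = *-≢0 x≢0 x≢0 x*x≡0

  inv-≢0 : ∀ x x≢0 → ¬ inv x x≢0 ≡ 0#
  inv-≢0 x x≢0 x⁻¹≡0 = 0≢1 (trans (sym (zeroʳ x)) (trans (cong (x *_) (sym x⁻¹≡0)) (proj₂ (inverse x x≢0))))

  0≤inv : ∀ x x≢0 → 0# ≤ x → 0# ≤ inv x x≢0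
  0≤inv x x≢0 0≤x with total 0# (inv x x≢0)
  ... | inj₁ 0≤x⁻¹ = 0≤x⁻¹
  ... | inj₂ x⁻¹≤0 = ⊥-elim (0≢1 (sym (nonneg-sum≡0⇒≡0ˡ 0≤1 0≤-1 (-‿inverseʳ 1#))))
    where
    0≤-1 : 0# ≤ - 1#
    0≤-1 = subst (0# ≤_) (trans (sym (-‿distribʳ-* x _)) (cong -_ (proj₂ (inverse x x≢0))))
                 (*-nonneg x _ 0≤x (x≤0⇒0≤-x x⁻¹≤0))

module ComplexNumbers (R : RealNumbers) where

  open RealNumbers R
  open Reals R using (ℝ-ring; ιᴿ)
  open Complex R public
  open import Algebra.Structures using (IsCommutativeRing)
  open import Data.Product using (_×_; _,_; proj₁; proj₂)
  open import Relation.Binary.PropositionalEquality using (refl; cong; cong₂; sym; trans; isEquivalence)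

  open CommutativeRing ℝ-ring using (+-assoc; +-comm; +-identityˡ; +-identityʳ; -‿inverseˡ; -‿inverseʳ)
  open IntegerCoefficients ℝ-ring using (solve; _:=_; _:+_; _:*_; _:-_; :-_; con; Polynomial)

  -- Complex arithmetic on solver expressions: it evaluates definitionally to _+ᶜ_ and _*ᶜ_, so the
  -- real solver proves complex identities componentwise.
  ℂₑ : ℕ → Set _
  ℂₑ n = Polynomial n × Polynomial n

  infix  8 ⊝_
  infixl 7 _⊗_
  infixl 6 _⊕_

  _⊕_ _⊗_ : ∀ {n} → ℂₑ n → ℂₑ n → ℂₑ n
  (a , b) ⊕ (c , d) = a :+ c , b :+ d
  (a , b) ⊗ (c , d) = a :* c :- b :* d , a :* d :+ b :* c

  ⊝_ : ∀ {n} → ℂₑ n → ℂₑ n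
  ⊝ (a , b) = :- a , :- b

  -ᶜ_ : ℂ → ℂ
  -ᶜ (a , b) = - a , - b

  ℂ-isCommutativeRing : IsCommutativeRing _≡_ _+ᶜ_ _*ᶜ_ -ᶜ_ 0ᶜ 1ᶜ
  ℂ-isCommutativeRing = record
    { isRing = record
      { +-isAbelianGroup = record
        { isGroup = record
          { isMonoid = record
            { isSemigroup = record
              { isMagma = record { isEquivalence = isEquivalence ; ∙-cong = cong₂ _+ᶜ_ }
              ; assoc   = λ x y z → cong₂ _,_ (+-assoc (re x) (re y) (re z)) (+-assoc (im x) (im y) (im z)) }
            ; identity = (λ x → cong₂ _,_ (+-identityˡ (re x)) (+-identityˡ (im x)))
                       , (λ x → cong₂ _,_ (+-identityʳ (re x)) (+-identityʳ (im x))) }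
          ; inverse = (λ x → cong₂ _,_ (-‿inverseˡ (re x)) (-‿inverseˡ (im x)))
                    , (λ x → cong₂ _,_ (-‿inverseʳ (re x)) (-‿inverseʳ (im x)))
          ; ⁻¹-cong = cong -ᶜ_ }
        ; comm = λ x y → cong₂ _,_ (+-comm (re x) (re y)) (+-comm (im x) (im y)) }
      ; *-cong     = cong₂ _*ᶜ_
      ; *-assoc    = λ x y z → cong₂ _,_
          (solve 6 (λ a b c d e f → proj₁ ((a , b) ⊗ (c , d) ⊗ (e , f)) := proj₁ ((a , b) ⊗ ((c , d) ⊗ (e , f)))) refl (re x) (im x) (re y) (im y) (re z) (im z))
          (solve 6 (λ a b c d e f → proj₂ ((a , b) ⊗ (c , d) ⊗ (e , f)) := proj₂ ((a , b) ⊗ ((c , d) ⊗ (e , f)))) refl (re x) (im x) (re y) (im y) (re z) (im z))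
      ; *-identity = (λ x → cong₂ _,_
                       (solve 2 (λ a b → proj₁ ((con (+ 1) , con (+ 0)) ⊗ (a , b)) := a) refl (re x) (im x))
                       (solve 2 (λ a b → proj₂ ((con (+ 1) , con (+ 0)) ⊗ (a , b)) := b) refl (re x) (im x)))
                   , (λ x → cong₂ _,_
                       (solve 2 (λ a b → proj₁ ((a , b) ⊗ (con (+ 1) , con (+ 0))) := a) refl (re x) (im x))
                       (solve 2 (λ a b → proj₂ ((a , b) ⊗ (con (+ 1) , con (+ 0))) := b) refl (re x) (im x)))
      ; distrib = (λ x y z → cong₂ _,_
                    (solve 6 (λ a b c d e f → proj₁ ((a , b) ⊗ ((c , d) ⊕ (e , f))) := proj₁ ((a , b) ⊗ (c , d) ⊕ (a , b) ⊗ (e , f))) refl (re x) (im x) (re y) (im y) (re z) (im z))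
                    (solve 6 (λ a b c d e f → proj₂ ((a , b) ⊗ ((c , d) ⊕ (e , f))) := proj₂ ((a , b) ⊗ (c , d) ⊕ (a , b) ⊗ (e , f))) refl (re x) (im x) (re y) (im y) (re z) (im z)))
                , (λ x y z → cong₂ _,_
                    (solve 6 (λ a b c d e f → proj₁ (((c , d) ⊕ (e , f)) ⊗ (a , b)) := proj₁ ((c , d) ⊗ (a , b) ⊕ (e , f) ⊗ (a , b))) refl (re x) (im x) (re y) (im y) (re z) (im z))
                    (solve 6 (λ a b c d e f → proj₂ (((c , d) ⊕ (e , f)) ⊗ (a , b)) := proj₂ ((c , d) ⊗ (a , b) ⊕ (e , f) ⊗ (a , b))) refl (re x) (im x) (re y) (im y) (re z) (im z)))
      }
    ; *-comm = λ x y → cong₂ _,_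
        (solve 4 (λ a b c d → proj₁ ((a , b) ⊗ (c , d)) := proj₁ ((c , d) ⊗ (a , b))) refl (re x) (im x) (re y) (im y))
        (solve 4 (λ a b c d → proj₂ ((a , b) ⊗ (c , d)) := proj₂ ((c , d) ⊗ (a , b))) refl (re x) (im x) (re y) (im y))
    }

  ℂ-ring : CommutativeRing _ _
  ℂ-ring = record { isCommutativeRing = ℂ-isCommutativeRing }

  open IntegerCoefficients ℂ-ring public using () renaming (ι to ιᶜ)

  ιᶜ≡ιᴿ : ∀ n → ιᶜ n ≡ (ιᴿ n , 0#)
  ιᶜ≡ιᴿ zero          = refl
  ιᶜ≡ιᴿ (suc zero)    = refl
  ιᶜ≡ιᴿ (suc (suc n)) = trans (cong (_+ᶜ 1ᶜ) (ιᶜ≡ιᴿ (suc n))) (cong (ιᴿ (suc (suc n)) ,_) (+-identityʳ 0#))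

  fromℕᴿ≡ιᴿ : ∀ n → fromℕᴿ n ≡ ιᴿ n
  fromℕᴿ≡ιᴿ zero          = refl
  fromℕᴿ≡ιᴿ (suc zero)    = +-identityʳ 1#
  fromℕᴿ≡ιᴿ (suc (suc n)) = trans (cong (λ x → 1# + x) (fromℕᴿ≡ιᴿ (suc n))) (+-comm 1# _)

  fromℕᶜ≡ιᶜ : ∀ n → fromℕᶜ n ≡ ιᶜ n
  fromℕᶜ≡ιᶜ n = trans (cong (_, 0#) (fromℕᴿ≡ιᴿ n)) (sym (ιᶜ≡ιᴿ n))

module RealZeros (R : RealNumbers) where

  open RealNumbers R
  open Reals R
  open ComplexNumbers R
  open NarayanaPolynomials ℂ-ring
  open CommutativeRing ℝ-ring using (*-comm)
  open Sums ℂ-ring using (∑<; ∑-cong; ∑-distribˡ)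
  open import Algebra.Definitions.RawSemiring (Semiring.rawSemiring (CommutativeRing.semiring ℂ-ring)) using (_^_)
  open import Data.Nat as ℕ using (⌊_/2⌋)
  open import Data.Product using (_,_)
  open import Relation.Nullary using (¬_)
  open import Relation.Binary.PropositionalEquality using (refl; cong; cong₂; sym; trans; subst; subst₂)
  open import Relation.Binary.PropositionalEquality.Properties using (module ≡-Reasoning)
  open ≡-Reasoning

  ^ᶜ≡^ : ∀ z n → z ^ᶜ n ≡ z ^ n
  ^ᶜ≡^ z zero    = refl
  ^ᶜ≡^ z (suc n) = cong (z *ᶜ_) (^ᶜ≡^ z n)

  sumFrom1≡∑ : ∀ K f → sumFrom1 K f ≡ ∑[ j < K ] f (suc j)
  sumFrom1≡∑ zero    f = refl
  sumFrom1≡∑ (suc K) f = cong (_+ᶜ f (suc K)) (sumFrom1≡∑ K f)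

  localHD≡m*z*narayana : ∀ m z → localHD R (2 ℕ.+ m) z ≡ ιᶜ m *ᶜ (z *ᶜ narayana m z)
  localHD≡m*z*narayana m z = begin
    localHD R (2 ℕ.+ m) z                                      ≡⟨ sumFrom1≡∑ K _ ⟩
    ∑[ j < K ] summand (suc j)                                 ≡⟨ ∑-cong K summand≡ ⟩
    ∑[ j < K ] (ιᶜ m *ᶜ (z *ᶜ term m z j))                      ≡⟨ ∑-distribˡ K (ιᶜ m) _ ⟩
    ιᶜ m *ᶜ (∑[ j < K ] (z *ᶜ term m z j))                      ≡⟨ cong (ιᶜ m *ᶜ_) (∑-distribˡ K z (term m z)) ⟩
    ιᶜ m *ᶜ (z *ᶜ narayana m z)                                ∎
    where
    K = suc ⌊ m /2⌋
    summand : ℕ → ℂ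
    summand i = fromℕᶜ (coeff (2 ℕ.+ m) i) *ᶜ ((z ^ᶜ i) *ᶜ ((1ᶜ +ᶜ z) ^ᶜ (2 ℕ.+ m ℕ.∸ 2 ℕ.* i)))
    summand≡ : ∀ j → summand (suc j) ≡ ιᶜ m *ᶜ (z *ᶜ term m z j)
    summand≡ j = begin
      summand (suc j)
        ≡⟨ cong₂ (λ c e → c *ᶜ ((z ^ᶜ suc j) *ᶜ ((1ᶜ +ᶜ z) ^ᶜ e))) (trans (fromℕᶜ≡ιᶜ (coeff (2 ℕ.+ m) (suc j))) (cong ιᶜ (coeff≡m*γ m j))) (cong (suc m ℕ.∸_) (ℕ.+-suc j (j ℕ.+ 0))) ⟩
      ιᶜ (m ℕ.* γ m j) *ᶜ ((z ^ᶜ suc j) *ᶜ ((1ᶜ +ᶜ z) ^ᶜ (m ℕ.∸ 2 ℕ.* j)))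
        ≡⟨ cong₂ (λ c p → c *ᶜ (p *ᶜ ((1ᶜ +ᶜ z) ^ᶜ (m ℕ.∸ 2 ℕ.* j)))) (×1-homo-* m (γ m j)) (^ᶜ≡^ z (suc j)) ⟩
      (ιᶜ m *ᶜ ιᶜ (γ m j)) *ᶜ ((z *ᶜ (z ^ j)) *ᶜ ((1ᶜ +ᶜ z) ^ᶜ (m ℕ.∸ 2 ℕ.* j)))
        ≡⟨ cong (λ q → (ιᶜ m *ᶜ ιᶜ (γ m j)) *ᶜ ((z *ᶜ (z ^ j)) *ᶜ q)) (^ᶜ≡^ (1ᶜ +ᶜ z) (m ℕ.∸ 2 ℕ.* j)) ⟩
      (ιᶜ m *ᶜ ιᶜ (γ m j)) *ᶜ ((z *ᶜ (z ^ j)) *ᶜ ((1ᶜ +ᶜ z) ^ (m ℕ.∸ 2 ℕ.* j)))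
        ≡⟨ solve 5 (λ a b z p q → (a :* b) :* ((z :* p) :* q) := a :* (z :* (b :* (p :* q)))) refl (ιᶜ m) (ιᶜ (γ m j)) z (z ^ j) ((1ᶜ +ᶜ z) ^ (m ℕ.∸ 2 ℕ.* j)) ⟩
      ιᶜ m *ᶜ (z *ᶜ term m z j)                                ∎
      where
      open IntegerCoefficients ℂ-ring using (solve; _:=_; _:*_)
      open import Algebra.Properties.Semiring.Mult.TCOptimised (CommutativeRing.semiring ℂ-ring) using (×1-homo-*)

  conj : ℂ → ℂ
  conj (a , b) = a , - b

  ‖_‖² : ℂ → Carrier
  ‖ x ‖² = re x * re x + im x * im x

  0≤‖x‖² : ∀ x → 0# ≤ ‖ x ‖²
  0≤‖x‖² x = 0≤x⇒0≤y⇒0≤x+y (0≤x*x (re x)) (0≤x*x (im x))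

  ‖x‖²≡0⇒¬¬x≡0 : ∀ x → ‖ x ‖² ≡ 0# → ¬ ¬ x ≡ 0ᶜ
  ‖x‖²≡0⇒¬¬x≡0 x ‖x‖²≡0 x≢0 =
    x*x≡0⇒¬¬x≡0 (nonneg-sum≡0⇒≡0ˡ (0≤x*x (re x)) (0≤x*x (im x)) ‖x‖²≡0) λ re≡0 →
    x*x≡0⇒¬¬x≡0 (nonneg-sum≡0⇒≡0ʳ (0≤x*x (re x)) (0≤x*x (im x)) ‖x‖²≡0) λ im≡0 →
    x≢0 (cong₂ _,_ re≡0 im≡0)

  real*y≡0⇒y≡0 : ∀ {r} y → ¬ r ≡ 0# → (r , 0#) *ᶜ y ≡ 0ᶜ → y ≡ 0ᶜ
  real*y≡0⇒y≡0 {r} y r≢0 r*y≡0 = cong₂ _,_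
    (x≢0⇒x*y≡0⇒y≡0 r≢0 (trans (solve 3 (λ r a b → r :* a := r :* a :- con (+ 0) :* b) refl r (re y) (im y)) (cong re r*y≡0)))
    (x≢0⇒x*y≡0⇒y≡0 r≢0 (trans (solve 3 (λ r a b → r :* b := r :* b :+ con (+ 0) :* a) refl r (re y) (im y)) (cong im r*y≡0)))
    where open IntegerCoefficients ℝ-ring using (solve; _:=_; _:+_; _:*_; _:-_; con)

  ιᶜ[1+n]*y≡0⇒y≡0 : ∀ n y → ιᶜ (suc n) *ᶜ y ≡ 0ᶜ → y ≡ 0ᶜ
  ιᶜ[1+n]*y≡0⇒y≡0 n y e = real*y≡0⇒y≡0 y (ιᴿ[1+n]≢0 n) (subst (λ c → c *ᶜ y ≡ 0ᶜ) (ιᶜ≡ιᴿ (suc n)) e)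

  narayana[1]≢0 : ∀ m → ¬ narayana m 1ᶜ ≡ 0ᶜ
  narayana[1]≢0 zero                N≡0 = 0≢1 (sym (cong re (trans (sym (narayana₀ 1ᶜ)) N≡0)))
  narayana[1]≢0 (suc zero)          N≡0 = ιᴿ[1+n]≢0 1 (cong re (trans (sym (narayana₁ 1ᶜ)) N≡0))
  narayana[1]≢0 (suc (suc k)) N≡0 =
    narayana[1]≢0 (suc k) (ιᶜ[1+n]*y≡0⇒y≡0 1 _ (ιᶜ[1+n]*y≡0⇒y≡0 (4 ℕ.+ 2 ℕ.* k) _ (begin
      ιᶜ (5 ℕ.+ 2 ℕ.* k) *ᶜ ((1ᶜ +ᶜ 1ᶜ) *ᶜ narayana (suc k) 1ᶜ)   ≡⟨ narayana-recurrence-at-1 k ⟨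
      ιᶜ (4 ℕ.+ k) *ᶜ narayana (2 ℕ.+ k) 1ᶜ                      ≡⟨ cong (ιᶜ (4 ℕ.+ k) *ᶜ_) N≡0 ⟩
      ιᶜ (4 ℕ.+ k) *ᶜ 0ᶜ                                         ≡⟨ CommutativeRing.zeroʳ ℂ-ring _ ⟩
      0ᶜ                                                         ∎)))

  open CommutativeRing ℂ-ring using () renaming (_-_ to _-ᶜ_)

  module Wronskian (z : ℂ) where

    open IntegerCoefficients ℝ-ring using (solve; _:=_; _:+_; _:*_; _:-_; :-_; con; Polynomial)
    open import Data.Product using (proj₂)

    -- w = 1 - conj z
    w : ℂ
    w = 1# + - re z , im z

    D : ℂ → ℂ → Carrier
    D x y = im ((x *ᶜ conj y) *ᶜ w)

    private
      conjₑ : ∀ {n} → ℂₑ n → ℂₑ n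
      conjₑ (a , b) = a , :- b

      1ₑ : ∀ {n} → ℂₑ n
      1ₑ = con (+ 1) , con (+ 0)

      realₑ : ∀ {n} → Polynomial n → ℂₑ n
      realₑ a = a , con (+ 0)

      Dₑ : ∀ {n} → ℂₑ n → ℂₑ n → ℂₑ n → Polynomial n
      Dₑ (p , s) x y = proj₂ ((x ⊗ conjₑ y) ⊗ (con (+ 1) :- p , s))

      ‖_‖ₑ : ∀ {n} → ℂₑ n → Polynomial n
      ‖ a , b ‖ₑ = a :* a :+ b :* b

    D-step : ∀ α β γ X Y W →
      (α , 0#) *ᶜ X ≡ (β , 0#) *ᶜ ((1ᶜ +ᶜ z) *ᶜ Y) -ᶜ (γ , 0#) *ᶜ ((1ᶜ -ᶜ z) *ᶜ ((1ᶜ -ᶜ z) *ᶜ W)) →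
      α * D X Y ≡ ιᴿ 2 * β * im z * ‖ Y ‖² + γ * ‖ 1ᶜ -ᶜ z ‖² * D Y W
    D-step α β γ X Y W αX≡ = begin
      α * D X Y          ≡⟨ solve 7 (λ α x₁ x₂ y₁ y₂ p s → α :* Dₑ (p , s) (x₁ , x₂) (y₁ , y₂) := Dₑ (p , s) (realₑ α ⊗ (x₁ , x₂)) (y₁ , y₂))
                              refl α (re X) (im X) (re Y) (im Y) (re z) (im z) ⟩
      D ((α , 0#) *ᶜ X) Y ≡⟨ cong (λ v → D v Y) αX≡ ⟩
      D ((β , 0#) *ᶜ ((1ᶜ +ᶜ z) *ᶜ Y) -ᶜ (γ , 0#) *ᶜ ((1ᶜ -ᶜ z) *ᶜ ((1ᶜ -ᶜ z) *ᶜ W))) Y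
        ≡⟨ solve 8 (λ β γ p s y₁ y₂ w₁ w₂ →
             let Z = (p , s) ; Y = (y₁ , y₂) ; W = (w₁ , w₂) in
             Dₑ Z (realₑ β ⊗ ((1ₑ ⊕ Z) ⊗ Y) ⊕ ⊝ (realₑ γ ⊗ ((1ₑ ⊕ ⊝ Z) ⊗ ((1ₑ ⊕ ⊝ Z) ⊗ W)))) Y
             := con (+ 2) :* β :* s :* ‖ Y ‖ₑ :+ γ :* ‖ 1ₑ ⊕ ⊝ Z ‖ₑ :* Dₑ Z Y W)
             refl β γ (re z) (im z) (re Y) (im Y) (re W) (im W) ⟩
      ιᴿ 2 * β * im z * ‖ Y ‖² + γ * ‖ 1ᶜ -ᶜ z ‖² * D Y W  ∎

    D-scale : ∀ x y → D (z *ᶜ x) (z *ᶜ y) ≡ ‖ z ‖² * D x y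
    D-scale x y = solve 6 (λ p s x₁ x₂ y₁ y₂ → let Z = (p , s) in
                    Dₑ Z (Z ⊗ (x₁ , x₂)) (Z ⊗ (y₁ , y₂)) := ‖ Z ‖ₑ :* Dₑ Z (x₁ , x₂) (y₁ , y₂))
                  refl (re z) (im z) (re x) (im x) (re y) (im y)

    D-zero : ∀ y → D 0ᶜ y ≡ 0#
    D-zero y = solve 4 (λ p s y₁ y₂ → Dₑ (p , s) (con (+ 0) , con (+ 0)) (y₁ , y₂) := con (+ 0)) refl (re z) (im z) (re y) (im y)

    im[zx*conj[x]] : ∀ x → im ((z *ᶜ x) *ᶜ conj x) ≡ im z * ‖ x ‖²
    im[zx*conj[x]] x = solve 4 (λ p s x₁ x₂ → proj₂ ((p , s) ⊗ (x₁ , x₂) ⊗ conjₑ (x₁ , x₂)) := s :* ‖ x₁ , x₂ ‖ₑ)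
                         refl (re z) (im z) (re x) (im x)

    F : ℕ → Carrier
    F zero    = ιᴿ 2
    F (suc k) = inv (ιᴿ (4 ℕ.+ k)) (ιᴿ[1+n]≢0 (3 ℕ.+ k))
              * (ιᴿ 2 * ιᴿ (5 ℕ.+ 2 ℕ.* k) * ‖ narayana (1 ℕ.+ k) z ‖² + ιᴿ (1 ℕ.+ k) * ‖ 1ᶜ -ᶜ z ‖² * F k)

    D≡im*F : ∀ k → D (narayana (1 ℕ.+ k) z) (narayana k z) ≡ im z * F k
    D≡im*F zero = begin
      D (narayana 1 z) (narayana 0 z)  ≡⟨ cong₂ D (narayana₁ z) (narayana₀ z) ⟩
      D (1ᶜ +ᶜ z) 1ᶜ                   ≡⟨ solve 2 (λ p s → Dₑ (p , s) (1ₑ ⊕ (p , s)) 1ₑ := s :* con (+ 2)) refl (re z) (im z) ⟩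
      im z * ιᴿ 2                      ∎
    D≡im*F (suc k) = trans (x*y≡z⇒y≡x⁻¹*z (ιᴿ[1+n]≢0 (3 ℕ.+ k)) (begin
      α * D X Y                                              ≡⟨ D-step α β γ′ X Y W recurrenceᴿ ⟩
      ιᴿ 2 * β * im z * ‖ Y ‖² + γ′ * ‖ 1ᶜ -ᶜ z ‖² * D Y W     ≡⟨ cong (λ d → ιᴿ 2 * β * im z * ‖ Y ‖² + γ′ * ‖ 1ᶜ -ᶜ z ‖² * d) (D≡im*F k) ⟩
      ιᴿ 2 * β * im z * ‖ Y ‖² + γ′ * ‖ 1ᶜ -ᶜ z ‖² * (im z * F k)
        ≡⟨ solve 6 (λ β s y γ n f → con (+ 2) :* β :* s :* y :+ γ :* n :* (s :* f) := s :* (con (+ 2) :* β :* y :+ γ :* n :* f))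
                   refl β (im z) ‖ Y ‖² γ′ ‖ 1ᶜ -ᶜ z ‖² (F k) ⟩
      im z * G                                               ∎))
      (solve 3 (λ a s g → a :* (s :* g) := s :* (a :* g)) refl (inv α _) (im z) G)
      where
      α = ιᴿ (4 ℕ.+ k)
      β = ιᴿ (5 ℕ.+ 2 ℕ.* k)
      γ′ = ιᴿ (1 ℕ.+ k)
      X = narayana (2 ℕ.+ k) z
      Y = narayana (1 ℕ.+ k) z
      W = narayana k z
      G = ιᴿ 2 * β * ‖ Y ‖² + γ′ * ‖ 1ᶜ -ᶜ z ‖² * F k
      recurrenceᴿ : (α , 0#) *ᶜ X ≡ (β , 0#) *ᶜ ((1ᶜ +ᶜ z) *ᶜ Y) -ᶜ (γ′ , 0#) *ᶜ ((1ᶜ -ᶜ z) *ᶜ ((1ᶜ -ᶜ z) *ᶜ W))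
      recurrenceᴿ = subst₂ (λ a b → a *ᶜ X ≡ b *ᶜ U -ᶜ (γ′ , 0#) *ᶜ V) (ιᶜ≡ιᴿ (4 ℕ.+ k)) (ιᶜ≡ιᴿ (5 ℕ.+ 2 ℕ.* k))
                      (subst (λ c → ιᶜ (4 ℕ.+ k) *ᶜ X ≡ ιᶜ (5 ℕ.+ 2 ℕ.* k) *ᶜ U -ᶜ c *ᶜ V) (ιᶜ≡ιᴿ (1 ℕ.+ k)) (narayana-recurrence z k))
        where
        U = (1ᶜ +ᶜ z) *ᶜ Y
        V = (1ᶜ -ᶜ z) *ᶜ ((1ᶜ -ᶜ z) *ᶜ W)

    0≤F : ∀ k → 0# ≤ F k
    0≤F zero    = 0≤ιᴿ 2
    0≤F (suc k) = *-nonneg _ _ (0≤inv _ _ (0≤ιᴿ (4 ℕ.+ k))) (0≤x⇒0≤y⇒0≤x+y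
      (*-nonneg _ _ (*-nonneg _ _ (0≤ιᴿ 2) (0≤ιᴿ (5 ℕ.+ 2 ℕ.* k))) (0≤‖x‖² _))
      (*-nonneg _ _ (*-nonneg _ _ (0≤ιᴿ (1 ℕ.+ k)) (0≤‖x‖² _)) (0≤F k)))

    F≢0 : ∀ k → ¬ F k ≡ 0#
    F≢0 zero    = ιᴿ[1+n]≢0 1
    F≢0 (suc k) F≡0 =
      ‖x‖²≡0⇒¬¬x≡0 _ ‖1-z‖²≡0 λ 1-z≡0 →
      ‖x‖²≡0⇒¬¬x≡0 _ ‖Y‖²≡0 λ Y≡0 →
      narayana[1]≢0 (1 ℕ.+ k) (subst (λ x → narayana (1 ℕ.+ k) x ≡ 0ᶜ) (sym (x∙y⁻¹≈ε⇒x≈y 1ᶜ z 1-z≡0)) Y≡0)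
      where
      open import Algebra.Properties.Ring (CommutativeRing.ring ℂ-ring) using (x∙y⁻¹≈ε⇒x≈y)
      Y = narayana (1 ℕ.+ k) z
      t₁ = ιᴿ 2 * ιᴿ (5 ℕ.+ 2 ℕ.* k) * ‖ Y ‖²
      t₂ = ιᴿ (1 ℕ.+ k) * ‖ 1ᶜ -ᶜ z ‖² * F k
      0≤t₁ : 0# ≤ t₁
      0≤t₁ = *-nonneg _ _ (*-nonneg _ _ (0≤ιᴿ 2) (0≤ιᴿ (5 ℕ.+ 2 ℕ.* k))) (0≤‖x‖² _)
      0≤t₂ : 0# ≤ t₂
      0≤t₂ = *-nonneg _ _ (*-nonneg _ _ (0≤ιᴿ (1 ℕ.+ k)) (0≤‖x‖² _)) (0≤F k)
      t₁+t₂≡0 : t₁ + t₂ ≡ 0#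
      t₁+t₂≡0 = x≢0⇒x*y≡0⇒y≡0 (inv-≢0 _ _) F≡0
      ‖Y‖²≡0 : ‖ Y ‖² ≡ 0#
      ‖Y‖²≡0 = x≢0⇒x*y≡0⇒y≡0 (*-≢0 (ιᴿ[1+n]≢0 1) (ιᴿ[1+n]≢0 (4 ℕ.+ 2 ℕ.* k))) (nonneg-sum≡0⇒≡0ˡ 0≤t₁ 0≤t₂ t₁+t₂≡0)
      ‖1-z‖²≡0 : ‖ 1ᶜ -ᶜ z ‖² ≡ 0#
      ‖1-z‖²≡0 = x≢0⇒x*y≡0⇒y≡0 (ιᴿ[1+n]≢0 k)
        (x≢0⇒x*y≡0⇒y≡0 (F≢0 k) (trans (*-comm (F k) _) (nonneg-sum≡0⇒≡0ʳ 0≤t₁ 0≤t₂ t₁+t₂≡0)))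

  localHD≡0⇒im≡0 : ∀ k z → localHD R (3 ℕ.+ k) z ≡ 0ᶜ → im z ≡ 0#
  localHD≡0⇒im≡0 k z localHD≡0 = x≢0⇒x*y≡0⇒y≡0 K≢0 K*im≡0
    where
    open Wronskian z
    open IntegerCoefficients ℝ-ring using (solve; _:=_; _:+_; _:*_; :-_; con)
    open import Data.Product using (proj₂)
    V = narayana (1 ℕ.+ k) z
    W = narayana k z
    zV≡0 : z *ᶜ V ≡ 0ᶜ
    zV≡0 = ιᶜ[1+n]*y≡0⇒y≡0 k _ (trans (sym (localHD≡m*z*narayana (1 ℕ.+ k) z)) localHD≡0)
    im*‖V‖²≡0 : im z * ‖ V ‖² ≡ 0#
    im*‖V‖²≡0 = begin
      im z * ‖ V ‖²              ≡⟨ im[zx*conj[x]] V ⟨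
      im ((z *ᶜ V) *ᶜ conj V)    ≡⟨ cong (λ c → im (c *ᶜ conj V)) zV≡0 ⟩
      im (0ᶜ *ᶜ conj V)          ≡⟨ solve 2 (λ a b → proj₂ ((con (+ 0) , con (+ 0)) ⊗ (a , :- b)) := con (+ 0)) refl (re V) (im V) ⟩
      0#                         ∎
    ‖z‖²*im≡0 : ‖ z ‖² * im z ≡ 0#
    ‖z‖²*im≡0 = x≢0⇒x*y≡0⇒y≡0 (F≢0 k) (begin
      F k * (‖ z ‖² * im z)       ≡⟨ solve 3 (λ f a s → f :* (a :* s) := a :* (s :* f)) refl (F k) ‖ z ‖² (im z) ⟩
      ‖ z ‖² * (im z * F k)       ≡⟨ cong (‖ z ‖² *_) (D≡im*F k) ⟨
      ‖ z ‖² * D V W              ≡⟨ D-scale V W ⟨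
      D (z *ᶜ V) (z *ᶜ W)         ≡⟨ cong (λ c → D c (z *ᶜ W)) zV≡0 ⟩
      D 0ᶜ (z *ᶜ W)               ≡⟨ D-zero (z *ᶜ W) ⟩
      0#                          ∎)
    K = ‖ z ‖² + ‖ V ‖²
    K*im≡0 : K * im z ≡ 0#
    K*im≡0 = begin
      (‖ z ‖² + ‖ V ‖²) * im z         ≡⟨ solve 3 (λ a b s → (a :+ b) :* s := a :* s :+ s :* b) refl ‖ z ‖² ‖ V ‖² (im z) ⟩
      ‖ z ‖² * im z + im z * ‖ V ‖²   ≡⟨ cong₂ _+_ ‖z‖²*im≡0 im*‖V‖²≡0 ⟩
      0# + 0#                         ≡⟨ CommutativeRing.+-identityʳ ℝ-ring 0# ⟩
      0#                              ∎
    K≢0 : ¬ K ≡ 0#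
    K≢0 K≡0 =
      ‖x‖²≡0⇒¬¬x≡0 z (nonneg-sum≡0⇒≡0ˡ (0≤‖x‖² z) (0≤‖x‖² V) K≡0) λ z≡0 →
      ‖x‖²≡0⇒¬¬x≡0 V (nonneg-sum≡0⇒≡0ʳ (0≤‖x‖² z) (0≤‖x‖² V) K≡0) λ V≡0 →
      0≢1 (sym (cong re (trans (sym (narayana-at-0 (1 ℕ.+ k))) (trans (cong (narayana (1 ℕ.+ k)) (sym z≡0)) V≡0))))

theorem3p4 : (R : RealNumbers) → (n : ℕ) → 2 ℕ.≤ n → Complex.OnlyRealZeros R (localHD R n)
theorem3p4 R (suc zero)          (ℕ.s≤s ())
theorem3p4 R (suc (suc zero))    _ = inj₁ λ z → ≡.trans (localHD≡m*z*narayana 0 z) (zeroˡ _)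
  where open RealZeros R
        open CommutativeRing (ComplexNumbers.ℂ-ring R) using (zeroˡ)
theorem3p4 R (suc (suc (suc k))) _ = inj₂ (RealZeros.localHD≡0⇒im≡0 R k)
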